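{- Let $G=(V,E)$ be a finite simple graph of order $n$ and let $T=n-1$. Let $(s,x,y,z)$ be an optimal solution of the model that minimizes $\sum_{v\in V}s_v+z$ subject to $s\in\{0,1\}^V$, $x\in\{0,\ldots,T\}^V$, $y\in\{0,1\}^A$, $z\in\{0,\ldots,T\}$ and (i) $s_v+\sum_{a=(u,v)\in A}y_a=1$ for all $v\in V$; (ii) $x_u-x_v+(T+1)y_a\le T$ for all $a=(u,v)\in A$; (iii) $x_w-x_v+(T+1)y_a\le T$ for all $a=(u,v)\in A$, $w\in N(u)\setminus\{v\}$; (iv) $x_v\le z$ for all $v\in V$. Then $C=\{v\in V: s_v=1\}$ is a zero forcing set of $G$ such that $\operatorname{th}(G)=\operatorname{th}(G,C)=\sum_{v\in V}s_v+z$.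
   Context: $N(u)$ is the neighborhood of $u$; $A$ contains both arcs $(u,v),(v,u)$ for each edge $\{u,v\}$. Standard zero forcing rule: a filled vertex $u$ forces a non-filled vertex $v$ if $v$ is the only non-filled neighbor of $u$. A zero forcing set is a set $C$ from which all vertices eventually become filled. $\operatorname{pt}(G,C)$ is the number of time steps needed to fill all vertices from $C$ when at each time step all possible forces are applied simultaneously ($\infty$ if $C$ is not a zero forcing set). The throttling number of $C$ is $\operatorname{th}(G,C)=|C|+\operatorname{pt}(G,C)$, and $\operatorname{th}(G)=\min_{C\subseteq V}\operatorname{th}(G,C)$. -}

module Defs where

open import Data.Nat using (ℕ; zero; suc; _+_; _*_; _∸_; _≤_; _<_)
open import Data.Nat.Base using (_≡ᵇ_)
open import Data.Bool using (Bool; true; false; _∧_; _∨_; not; if_then_else_)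
open import Data.Fin using (Fin)
open import Data.Fin.Properties using () renaming (_≟_ to _≟ᶠ_)
open import Data.List using (List; map; allFin; filter; length)
open import Data.Nat.ListAction using (sum)
open import Data.Bool.ListAction using (any; all)
open import Data.Product using (Σ; _×_; _,_; ∃)
open import Relation.Binary.PropositionalEquality using (_≡_; _≢_)
open import Relation.Nullary.Decidable using (⌊_⌋)

record Graph (n : ℕ) : Set where
  field
    adj   : Fin n → Fin n → Bool
    sym   : ∀ u v → adj u v ≡ adj v u
    irref : ∀ v → adj v v ≡ false
open Graph public

VSet : ℕ → Set
VSet n = Fin n → Bool

card : ∀ {n} → VSet n → ℕ
card {n} C = length (filter (λ v → C v Data.Bool.≟ true) (allFin n))
  where import Data.Bool

sumV : ∀ {n} → (Fin n → ℕ) → ℕ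
sumV {n} f = sum (map f (allFin n))

-- one simultaneous application of the zero forcing rule:
-- v becomes filled if it already is, or some filled neighbour u of v has
-- every neighbour w ≠ v filled (so v is u's only non-filled neighbour).
step : ∀ {n} → Graph n → VSet n → VSet n
step {n} G F v =
  F v ∨ any (λ u → F u ∧ adj G u v ∧
               all (λ w → not (adj G u w) ∨ ⌊ w ≟ᶠ v ⌋ ∨ F w) (allFin n))
            (allFin n)

filledAt : ∀ {n} → Graph n → VSet n → ℕ → VSet n
filledAt G C zero    = C
filledAt G C (suc k) = step G (filledAt G C k)

AllFilled : ∀ {n} → VSet n → Set
AllFilled {n} F = ∀ (v : Fin n) → F v ≡ true

IsZeroForcingSet : ∀ {n} → Graph n → VSet n → Set
IsZeroForcingSet G C = ∃ λ k → AllFilled (filledAt G C k)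

IsPT : ∀ {n} → Graph n → VSet n → ℕ → Set
IsPT G C k = AllFilled (filledAt G C k) × (∀ j → j < k → ¬AF (filledAt G C j))
  where
    ¬AF : _ → Set
    ¬AF F = AllFilled F → Data.Empty.⊥
      where import Data.Empty

-- th(G,C) = t   (finite; th(G,C)=∞ iff C is not a zero forcing set)
IsThC : ∀ {n} → Graph n → VSet n → ℕ → Set
IsThC G C t = Σ ℕ λ k → IsPT G C k × card C + k ≡ t

IsTh : ∀ {n} → Graph n → ℕ → Set
IsTh {n} G t = (Σ (VSet n) λ C → IsThC G C t)
             × (∀ (C : VSet n) t' → IsThC G C t' → t ≤ t')

-- The integer programming model, with T = n - 1.
-- s v ∈ {0,1}, x v ∈ {0..T}, y u v ∈ {0,1} for arcs (u,v) (values of y on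
-- non-arcs are irrelevant and unconstrained), z ∈ {0..T}.
-- Inequalities a - b + c ≤ T are written a + c ≤ T + b (over ℕ, equivalent).
record Feasible {n : ℕ} (G : Graph n)
                (s : Fin n → ℕ) (x : Fin n → ℕ) (y : Fin n → Fin n → ℕ) (z : ℕ) : Set where
  field
    s-bin : ∀ v → s v ≤ 1
    x-rng : ∀ v → x v ≤ n ∸ 1
    y-bin : ∀ u v → adj G u v ≡ true → y u v ≤ 1
    z-rng : z ≤ n ∸ 1
    c-i   : ∀ v → s v + sumV (λ u → if adj G u v then y u v else 0) ≡ 1
    c-ii  : ∀ u v → adj G u v ≡ true → x u + ((n ∸ 1) + 1) * y u v ≤ (n ∸ 1) + x v
    c-iii : ∀ u v w → adj G u v ≡ true → adj G u w ≡ true → w ≢ v →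
              x w + ((n ∸ 1) + 1) * y u v ≤ (n ∸ 1) + x v
    c-iv  : ∀ v → x v ≤ z

objective : ∀ {n} → (Fin n → ℕ) → ℕ → ℕ
objective s z = sumV s + z

Optimal : ∀ {n : ℕ} (G : Graph n)
          (s : Fin n → ℕ) (x : Fin n → ℕ) (y : Fin n → Fin n → ℕ) (z : ℕ) → Set
Optimal {n} G s x y z =
  Feasible G s x y z ×
  (∀ s' x' y' z' → Feasible G s' x' y' z' → objective s z ≤ objective s' z')

support : ∀ {n} → (Fin n → ℕ) → VSet n
support s v = s v ≡ᵇ 1

{-# OPTIONS --safe #-}
module Submission where

-- A feasible point (s, x, y, z) is a chronological list of forces: a vertex v
-- with s_v = 0 has exactly one arc (u, v) with y = 1, and constraints (ii) and
-- (iii) put u and all its other neighbours strictly before v in the order x.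
-- By induction on time every vertex is filled by time x_v ≤ z, so the support
-- of s is a zero forcing set with propagation time at most z.  Conversely, a
-- zero forcing set C with propagation time k yields a feasible point of value
-- |C| + k: x_v is the time v is first filled, y picks one force filling each
-- v ∉ C, and k ≤ n - 1 because C ≠ ∅ and every time step fills a new vertex.
-- Optimality therefore bounds the objective by every th(G, C), and for the
-- support of s the bound is attained.

open import Defs hiding (sym)
open import Data.Bool as Bool using (Bool; true; false; _∧_; _∨_; not; if_then_else_)
open import Data.Bool.ListAction using (any; all)
open import Data.Bool.Properties using (T-≡; ∨-zeroʳ; ¬-not)
open import Data.Fin using (Fin; zero; suc)
open import Data.Fin.Properties using (any?; all?) renaming (_≟_ to _≟ᶠ_)
open import Data.List using ([]; _∷_; map; allFin; filter; length)
open import Data.List.Properties using (map-tabulate; map-cong; length-filter; length-tabulate)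
open import Data.List.Membership.Propositional using (lose)
open import Data.List.Membership.Propositional.Properties using (∈-allFin)
open import Data.List.Relation.Unary.All as All using ()
open import Data.List.Relation.Unary.All.Properties using (all⁺; all⁻)
open import Data.List.Relation.Unary.Any using (satisfied)
open import Data.List.Relation.Unary.Any.Properties using (any⁺; any⁻)
open import Data.Nat
  using (ℕ; zero; suc; pred; _+_; _*_; _∸_; _≤_; _<_; z≤n; s≤s; s≤s⁻¹; _≡ᵇ_; ≢-nonZero)
open import Data.Nat.ListAction using (sum)
open import Data.Nat.Properties
open import Data.Nat.Tactic.RingSolver using (solve-∀)
open import Data.Product using (_×_; _,_; ∃-syntax; proj₁; proj₂)
open import Data.Sum using (_⊎_; inj₁; inj₂)
open import Function using (_∘_; id; Equivalence)
open import Relation.Nullary using (¬_; Dec; yes; no; contradiction)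
open import Relation.Nullary.Decidable using (⌊_⌋; map′; _×-dec_)
open import Relation.Unary using (Decidable)
open import Relation.Binary.PropositionalEquality

sumV-suc : ∀ {n} (f : Fin (suc n) → ℕ) → sumV f ≡ f zero + sumV (f ∘ suc)
sumV-suc f = cong (λ xs → f zero + sum xs)
  (trans (map-tabulate suc f) (sym (map-tabulate id (f ∘ suc))))

sumV-cong : ∀ {n} {f g : Fin n → ℕ} → (∀ i → f i ≡ g i) → sumV f ≡ sumV g
sumV-cong {n} f≗g = cong sum (map-cong f≗g (allFin n))

sumV-zero : ∀ {n} {f : Fin n → ℕ} → (∀ i → f i ≡ 0) → sumV f ≡ 0
sumV-zero {zero}      _   = refl
sumV-zero {suc n} {f} f≡0 =
  trans (sumV-suc f) (cong₂ _+_ (f≡0 zero) (sumV-zero (f≡0 ∘ suc)))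

sumV-mono-≤ : ∀ {n} {f g : Fin n → ℕ} → (∀ i → f i ≤ g i) → sumV f ≤ sumV g
sumV-mono-≤ {zero}          _   = z≤n
sumV-mono-≤ {suc n} {f} {g} f≤g rewrite sumV-suc f | sumV-suc g =
  +-mono-≤ (f≤g zero) (sumV-mono-≤ (f≤g ∘ suc))

sumV-mono-< : ∀ {n} {f g : Fin n → ℕ} → (∀ i → f i ≤ g i) → ∀ j → f j < g j → sumV f < sumV g
sumV-mono-< {suc n} {f} {g} f≤g zero f₀<g₀ rewrite sumV-suc f | sumV-suc g =
  +-mono-<-≤ f₀<g₀ (sumV-mono-≤ (f≤g ∘ suc))
sumV-mono-< {suc n} {f} {g} f≤g (suc j) fj<gj rewrite sumV-suc f | sumV-suc g =
  +-mono-≤-< (f≤g zero) (sumV-mono-< (f≤g ∘ suc) j fj<gj)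

sumV≢0 : ∀ {n} {f : Fin n → ℕ} → sumV f ≢ 0 → ∃[ i ] f i ≢ 0
sumV≢0 {zero}      Σ≢0 = contradiction refl Σ≢0
sumV≢0 {suc n} {f} Σ≢0 with f zero ≟ 0
... | no  f₀≢0 = zero , f₀≢0
... | yes f₀≡0 =
  let i , fi≢0 = sumV≢0 (λ rest≡0 → Σ≢0 (trans (sumV-suc f) (cong₂ _+_ f₀≡0 rest≡0)))
  in  suc i , fi≢0

δ : ∀ {n} → Fin n → Fin n → ℕ
δ zero    zero    = 1
δ zero    (suc _) = 0
δ (suc _) zero    = 0
δ (suc c) (suc u) = δ c u

δ≤1 : ∀ {n} (c u : Fin n) → δ c u ≤ 1
δ≤1 zero    zero    = ≤-refl
δ≤1 zero    (suc _) = z≤n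
δ≤1 (suc _) zero    = z≤n
δ≤1 (suc c) (suc u) = δ≤1 c u

δ-off-diag : ∀ {n} {c u : Fin n} → u ≢ c → δ c u ≡ 0
δ-off-diag {c = zero}  {zero}  u≢c = contradiction refl u≢c
δ-off-diag {c = zero}  {suc _} _   = refl
δ-off-diag {c = suc _} {zero}  _   = refl
δ-off-diag {c = suc c} {suc u} u≢c = δ-off-diag (u≢c ∘ cong suc)

sumV-δ : ∀ {n} (c : Fin n) → sumV (δ c) ≡ 1
sumV-δ {suc n} zero    =
  trans (sumV-suc {n} (δ zero)) (cong suc (sumV-zero {n} {δ zero ∘ suc} λ _ → refl))
sumV-δ {suc n} (suc c) = trans (sumV-suc {n} (δ (suc c))) (sumV-δ c)

indicator : ∀ {n} → VSet n → Fin n → ℕ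
indicator F v = if F v then 1 else 0

indicator-∈ : ∀ {n} {F : VSet n} {v} → F v ≡ true → indicator F v ≡ 1
indicator-∈ = cong (λ b → if b then 1 else 0)

indicator-∉ : ∀ {n} {F : VSet n} {v} → F v ≡ false → indicator F v ≡ 0
indicator-∉ = cong (λ b → if b then 1 else 0)

indicator≤1 : ∀ {n} (F : VSet n) v → indicator F v ≤ 1
indicator≤1 F v with F v
... | true  = ≤-refl
... | false = z≤n

indicator-support : ∀ {n} {s : Fin n → ℕ} {v} → s v ≤ 1 → indicator (support s) v ≡ s v
indicator-support sv≤1 with n≤1⇒n≡0∨n≡1 sv≤1
... | inj₁ sv≡0 rewrite sv≡0 = refl
... | inj₂ sv≡1 rewrite sv≡1 = refl

_⊆_ : ∀ {n} → VSet n → VSet n → Set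
F ⊆ F′ = ∀ v → F v ≡ true → F′ v ≡ true

card≡sumV-indicator : ∀ {n} (F : VSet n) → card F ≡ sumV (indicator F)
card≡sumV-indicator {n} F = count (allFin n)
  where
  count : ∀ vs → length (filter (λ v → F v Bool.≟ true) vs) ≡ sum (map (indicator F) vs)
  count []       = refl
  count (v ∷ vs) with F v
  ... | true  = cong suc (count vs)
  ... | false = count vs

card≤n : ∀ {n} (F : VSet n) → card F ≤ n
card≤n {n} F = ≤-trans (length-filter (λ v → F v Bool.≟ true) (allFin n))
                       (≤-reflexive (length-tabulate id))

card-< : ∀ {n} {F F′ : VSet n} {v} → F ⊆ F′ → F v ≡ false → F′ v ≡ true → card F < card F′
card-< {F = F} {F′} {v} F⊆F′ v∉F v∈F′
  rewrite card≡sumV-indicator F | card≡sumV-indicator F′ =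
  sumV-mono-< indicator-mono v
    (subst₂ _<_ (sym (indicator-∉ {F = F} v∉F)) (sym (indicator-∈ {F = F′} v∈F′)) ≤-refl)
  where
  indicator-mono : ∀ w → indicator F w ≤ indicator F′ w
  indicator-mono w with F w in w∈F
  ... | true  = ≤-reflexive (sym (indicator-∈ {F = F′} (F⊆F′ w w∈F)))
  ... | false = z≤n

card>0 : ∀ {n} {F : VSet n} {v} → F v ≡ true → 0 < card F
card>0 {n} {F} v∈F =
  subst (_< card F) card-∅ (card-< {F = ∅} {F} (λ _ ()) refl v∈F)
  where
  ∅ : VSet n
  ∅ _ = false
  card-∅ : card ∅ ≡ 0
  card-∅ = trans (card≡sumV-indicator ∅) (sumV-zero {f = indicator ∅} λ _ → refl)

card-support : ∀ {n} {s : Fin n → ℕ} → (∀ v → s v ≤ 1) → card (support s) ≡ sumV s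
card-support {s = s} s-bin =
  trans (card≡sumV-indicator (support s))
        (sumV-cong {f = indicator (support s)} {s} (indicator-support {s = s} ∘ s-bin))

∧≡true⁻ : ∀ a {b} → a ∧ b ≡ true → a ≡ true × b ≡ true
∧≡true⁻ true b≡true = refl , b≡true

∨≡true⁻ : ∀ a {b} → a ∨ b ≡ true → a ≡ true ⊎ b ≡ true
∨≡true⁻ true  _      = inj₁ refl
∨≡true⁻ false b≡true = inj₂ b≡true

any-allFin⁻ : ∀ {n} {p : Fin n → Bool} → any p (allFin n) ≡ true → ∃[ i ] p i ≡ true
any-allFin⁻ {n} {p} h =
  let i , pi = satisfied (any⁻ p (allFin n) (Equivalence.from T-≡ h))
  in  i , Equivalence.to T-≡ pi

any-allFin⁺ : ∀ {n} {p : Fin n → Bool} {i} → p i ≡ true → any p (allFin n) ≡ true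
any-allFin⁺ {p = p} {i} pi =
  Equivalence.to T-≡ (any⁺ p (lose (∈-allFin i) (Equivalence.from T-≡ pi)))

all-allFin⁻ : ∀ {n} {p : Fin n → Bool} → all p (allFin n) ≡ true → ∀ i → p i ≡ true
all-allFin⁻ {p = p} h i =
  Equivalence.to T-≡ (All.lookup (all⁺ p _ (Equivalence.from T-≡ h)) (∈-allFin i))

all-allFin⁺ : ∀ {n} {p : Fin n → Bool} → (∀ i → p i ≡ true) → all p (allFin n) ≡ true
all-allFin⁺ {n} {p} h =
  Equivalence.to T-≡
    (all⁻ p {xs = allFin n} (All.tabulate λ {i} _ → Equivalence.from T-≡ (h i)))

least-satisfying : ∀ {p} {P : ℕ → Set p} → Decidable P → ∀ {b} → P b →
                   ∃[ k ] (P k × k ≤ b × (∀ j → j < k → ¬ P j))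
least-satisfying P? {zero} P₀ = 0 , P₀ , z≤n , λ _ ()
least-satisfying P? {suc b} Pb with P? 0
... | yes P₀ = 0 , P₀ , z≤n , λ _ ()
... | no ¬P₀ =
  let k , Pk , k≤b , below-k = least-satisfying (P? ∘ suc) Pb
  in  suc k , Pk , s≤s k≤b , λ where
        zero    _         → ¬P₀
        (suc j) (s≤s j<k) → below-k j j<k

big-M-term-0 : ∀ a T → a + (T + 1) * 0 ≡ a
big-M-term-0 = solve-∀

big-M-term-1 : ∀ a T → a + (T + 1) * 1 ≡ T + suc a
big-M-term-1 = solve-∀

big-M-active : ∀ {a b T y} → y ≡ 1 → a + (T + 1) * y ≤ T + b → a < b
big-M-active {a} {b} {T} refl le =
  +-cancelˡ-≤ T (suc a) b (subst (_≤ T + b) (big-M-term-1 a T) le)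

big-M : ∀ {a b T y} → y ≤ 1 → a ≤ T → (y ≡ 1 → a < b) → a + (T + 1) * y ≤ T + b
big-M {a} {b} {T} y≤1 a≤T active with n≤1⇒n≡0∨n≡1 y≤1
... | inj₁ refl =
  subst (_≤ T + b) (sym (big-M-term-0 a T)) (≤-trans a≤T (m≤m+n T b))
... | inj₂ refl =
  subst (_≤ T + b) (sym (big-M-term-1 a T)) (+-monoʳ-≤ T (active refl))

module _ {n} (G : Graph n) where

  Forces : VSet n → Fin n → Fin n → Set
  Forces F u v =
    F u ≡ true × adj G u v ≡ true × (∀ w → adj G u w ≡ true → w ≢ v → F w ≡ true)

  -- Verbatim the test inside step, so step G F v is F v ∨ any (forcesᵇ F v) (allFin n).
  forcesᵇ : VSet n → Fin n → Fin n → Bool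
  forcesᵇ F v u = F u ∧ adj G u v ∧ all (λ w → not (adj G u w) ∨ ⌊ w ≟ᶠ v ⌋ ∨ F w) (allFin n)

  forcesᵇ⇒Forces : ∀ {F u v} → forcesᵇ F v u ≡ true → Forces F u v
  forcesᵇ⇒Forces {F} {u} {v} h =
    let u∈F , rest = ∧≡true⁻ (F u) h
        uv , others = ∧≡true⁻ (adj G u v) rest
    in  u∈F , uv , λ w → other-filled (all-allFin⁻ others w)
    where
    other-filled : ∀ {w} → (not (adj G u w) ∨ ⌊ w ≟ᶠ v ⌋ ∨ F w) ≡ true →
                   adj G u w ≡ true → w ≢ v → F w ≡ true
    other-filled {w} h uw w≢v rewrite uw with w ≟ᶠ v
    ... | yes w≡v = contradiction w≡v w≢v
    ... | no  _   = h

  Forces⇒forcesᵇ : ∀ {F u v} → Forces F u v → forcesᵇ F v u ≡ true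
  Forces⇒forcesᵇ {F} {u} {v} (u∈F , uv , others) rewrite u∈F | uv =
    all-allFin⁺ other-filled
    where
    other-filled : ∀ w → (not (adj G u w) ∨ ⌊ w ≟ᶠ v ⌋ ∨ F w) ≡ true
    other-filled w with adj G u w in uw
    ... | false = refl
    ... | true with w ≟ᶠ v
    ...   | yes _   = refl
    ...   | no  w≢v = others w uw w≢v

  forces? : ∀ F u v → Dec (Forces F u v)
  forces? F u v = map′ forcesᵇ⇒Forces Forces⇒forcesᵇ (forcesᵇ F v u Bool.≟ true)

  step-extensive : ∀ F → F ⊆ step G F
  step-extensive F v v∈F rewrite v∈F = refl

  step-forces : ∀ {F u v} → Forces F u v → step G F v ≡ true
  step-forces {F} {v = v} u→v =
    trans (cong (F v ∨_) (any-allFin⁺ {p = forcesᵇ F v} (Forces⇒forcesᵇ u→v))) (∨-zeroʳ (F v))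

  step-sound : ∀ {F v} → step G F v ≡ true → F v ≡ true ⊎ ∃[ u ] Forces F u v
  step-sound {F} {v} h with ∨≡true⁻ (F v) h
  ... | inj₁ v∈F    = inj₁ v∈F
  ... | inj₂ forced = let u , h = any-allFin⁻ forced in inj₂ (u , forcesᵇ⇒Forces h)

  step-mono : ∀ {F F′} → F ⊆ F′ → step G F ⊆ step G F′
  step-mono {F′ = F′} F⊆F′ v h with step-sound h
  ... | inj₁ v∈F                    = step-extensive F′ v (F⊆F′ v v∈F)
  ... | inj₂ (u , u∈F , uv , others) =
    step-forces (F⊆F′ u u∈F , uv , λ w uw w≢v → F⊆F′ w (others w uw w≢v))

  filledAt-mono : ∀ C {j t} → j ≤ t → filledAt G C j ⊆ filledAt G C t
  filledAt-mono C {t = zero} z≤n v h = h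
  filledAt-mono C {j} {suc t} j≤1+t v h with m≤n⇒m<n∨m≡n j≤1+t
  ... | inj₁ j<1+t =
    step-extensive (filledAt G C t) v (filledAt-mono C {j} {t} (s≤s⁻¹ j<1+t) v h)
  ... | inj₂ refl  = h

  filledAt-stalls : ∀ C {j} → filledAt G C (suc j) ⊆ filledAt G C j →
                    ∀ d → filledAt G C (d + j) ⊆ filledAt G C j
  filledAt-stalls C stalled zero    v h = h
  filledAt-stalls C stalled (suc d) v h =
    stalled v (step-mono (filledAt-stalls C stalled d) v h)

  allFilled⇒IsPT : ∀ C {b} → AllFilled (filledAt G C b) → ∃[ k ] (IsPT G C k × k ≤ b)
  allFilled⇒IsPT C filled-b =
    let k , filled-k , k≤b , below-k =
          least-satisfying {P = λ t → AllFilled (filledAt G C t)} allFilled? filled-b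
    in  k , (filled-k , below-k) , k≤b
    where
    allFilled? : ∀ t → Dec (AllFilled (filledAt G C t))
    allFilled? t = all? (λ v → filledAt G C t v Bool.≟ true)

  module _ {C : VSet n} {k : ℕ} (pt : IsPT G C k) where

    newly-filled : ∀ {j} → j < k →
                   ∃[ v ] (filledAt G C j v ≡ false × filledAt G C (suc j) v ≡ true)
    newly-filled {j} j<k with any? (λ v →
      (filledAt G C j v Bool.≟ false) ×-dec (filledAt G C (suc j) v Bool.≟ true))
    ... | yes new  = new
    ... | no  none = contradiction filled-j (proj₂ pt j j<k)
      where
      stalled : filledAt G C (suc j) ⊆ filledAt G C j
      stalled v h with filledAt G C j v Bool.≟ true
      ... | yes v∈Fj = v∈Fj
      ... | no  v∉Fj = contradiction (v , ¬-not v∉Fj , h) none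
      filled-j : AllFilled (filledAt G C j)
      filled-j v = filledAt-stalls C stalled (k ∸ j) v
        (subst (λ t → filledAt G C t v ≡ true) (sym (m∸n+n≡m (<⇒≤ j<k))) (proj₁ pt v))

    card-filledAt-grows : ∀ {j} → j ≤ k → card C + j ≤ card (filledAt G C j)
    card-filledAt-grows {zero}  _   = ≤-reflexive (+-identityʳ (card C))
    card-filledAt-grows {suc j} j<k =
      let v , v∉Fj , v∈Fj+1 = newly-filled j<k in begin
      card C + suc j                ≡⟨ +-suc (card C) j ⟩
      suc (card C + j)              ≤⟨ s≤s (card-filledAt-grows (<⇒≤ j<k)) ⟩
      suc (card (filledAt G C j))   ≤⟨ card-< (step-extensive _) v∉Fj v∈Fj+1 ⟩
      card (filledAt G C (suc j))   ∎
      where open ≤-Reasoning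

    initial-nonempty : 0 < k → ∃[ u ] C u ≡ true
    initial-nonempty 0<k with newly-filled 0<k
    ... | v , v∉C , v∈F₁ with step-sound v∈F₁
    ...   | inj₁ v∈C           = contradiction (trans (sym v∈C) v∉C) λ ()
    ...   | inj₂ (u , u∈C , _) = u , u∈C

    pt≤n∸1 : k ≤ n ∸ 1
    pt≤n∸1 with k ≟ 0
    ... | yes k≡0 = subst (_≤ n ∸ 1) (sym k≡0) z≤n
    ... | no  k≢0 = ∸-monoˡ-≤ 1 k<n
      where
      open ≤-Reasoning
      k<n : k < n
      k<n = let u , u∈C = initial-nonempty (n≢0⇒n>0 k≢0) in begin-strict
        k                       <⟨ +-monoˡ-< k (card>0 {F = C} u∈C) ⟩
        card C + k              ≤⟨ card-filledAt-grows ≤-refl ⟩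
        card (filledAt G C k)   ≤⟨ card≤n _ ⟩
        n                       ∎

  module ForcingSolution {C : VSet n} {k : ℕ} (pt : IsPT G C k) where

    firstFill-spec : ∀ v → ∃[ t ] ( filledAt G C t v ≡ true × t ≤ k
                                  × (∀ j → j < t → ¬ filledAt G C j v ≡ true))
    firstFill-spec v = least-satisfying {P = λ t → filledAt G C t v ≡ true}
                                        (λ t → filledAt G C t v Bool.≟ true) (proj₁ pt v)

    firstFill : Fin n → ℕ
    firstFill v = proj₁ (firstFill-spec v)

    firstFill-filled : ∀ v → filledAt G C (firstFill v) v ≡ true
    firstFill-filled v = proj₁ (proj₂ (firstFill-spec v))

    firstFill≤pt : ∀ v → firstFill v ≤ k
    firstFill≤pt v = proj₁ (proj₂ (proj₂ (firstFill-spec v)))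

    firstFill-least : ∀ {v j} → filledAt G C j v ≡ true → firstFill v ≤ j
    firstFill-least {v} h = ≮⇒≥ λ j<t → proj₂ (proj₂ (proj₂ (firstFill-spec v))) _ j<t h

    suc-pred-firstFill : ∀ {v} → C v ≡ false → suc (pred (firstFill v)) ≡ firstFill v
    suc-pred-firstFill {v} v∉C = suc-pred (firstFill v) {{≢-nonZero firstFill≢0}}
      where
      firstFill≢0 : firstFill v ≢ 0
      firstFill≢0 t≡0 = contradiction
        (trans (sym (subst (λ t → filledAt G C t v ≡ true) t≡0 (firstFill-filled v))) v∉C) λ ()

    firstFill-earlier : ∀ {v w} → C v ≡ false → filledAt G C (pred (firstFill v)) w ≡ true →
                        firstFill w < firstFill v
    firstFill-earlier v∉C h =
      ≤-<-trans (firstFill-least h) (≤-reflexive (suc-pred-firstFill v∉C))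

    newly-forced : ∀ {v} → C v ≡ false → ∃[ u ] Forces (filledAt G C (pred (firstFill v))) u v
    newly-forced {v} v∉C with step-sound
      (subst (λ t → filledAt G C t v ≡ true) (sym (suc-pred-firstFill v∉C)) (firstFill-filled v))
    ... | inj₁ filled-earlier = contradiction (firstFill-least filled-earlier)
                                  (<⇒≱ (≤-reflexive (suc-pred-firstFill v∉C)))
    ... | inj₂ forced         = forced

    -- The fallback v is junk: it can only arise for v ∈ C, where forcingArc ignores forcer v.
    forcer : Fin n → Fin n
    forcer v with any? (λ u → forces? (filledAt G C (pred (firstFill v))) u v)
    ... | yes (u , _) = u
    ... | no  _       = v

    forcer-forces : ∀ {v} → C v ≡ false →
                    Forces (filledAt G C (pred (firstFill v))) (forcer v) v
    forcer-forces {v} v∉C with any? (λ u → forces? (filledAt G C (pred (firstFill v))) u v)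
    ... | yes (_ , forces) = forces
    ... | no  none         = contradiction (newly-forced v∉C) none

    forcingArc : Fin n → Fin n → ℕ
    forcingArc u v = if C v then 0 else δ (forcer v) u

    forcingArc≤1 : ∀ u v → forcingArc u v ≤ 1
    forcingArc≤1 u v with C v
    ... | true  = z≤n
    ... | false = δ≤1 (forcer v) u

    active-arc-forces : ∀ {u v} → forcingArc u v ≡ 1 →
                        C v ≡ false × Forces (filledAt G C (pred (firstFill v))) u v
    active-arc-forces {u} {v} arc≡1 with C v in v∉C
    ... | true  = contradiction arc≡1 λ ()
    ... | false with u ≟ᶠ forcer v
    ...   | yes refl = refl , forcer-forces v∉C
    ...   | no  u≢c  = contradiction (trans (sym (δ-off-diag u≢c)) arc≡1) λ ()

    one-in-arc : ∀ v → indicator C v + sumV (λ u → if adj G u v then forcingArc u v else 0) ≡ 1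
    one-in-arc v with C v in v∉C
    ... | true  = cong suc (sumV-zero no-arc)
      where
      no-arc : ∀ u → (if adj G u v then 0 else 0) ≡ 0
      no-arc u with adj G u v
      ... | true  = refl
      ... | false = refl
    ... | false = trans (sumV-cong arc-δ) (sumV-δ (forcer v))
      where
      arc-δ : ∀ u → (if adj G u v then δ (forcer v) u else 0) ≡ δ (forcer v) u
      arc-δ u with adj G u v in uv | u ≟ᶠ forcer v
      ... | true  | _        = refl
      ... | false | no u≢c   = sym (δ-off-diag u≢c)
      ... | false | yes refl =
        contradiction (trans (sym uv) (proj₁ (proj₂ (forcer-forces v∉C)))) λ ()

    feasible : Feasible G (indicator C) firstFill forcingArc k
    feasible = record
      { s-bin = indicator≤1 C
      ; x-rng = firstFill≤T
      ; y-bin = λ u v _ → forcingArc≤1 u v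
      ; z-rng = pt≤n∸1 pt
      ; c-i   = one-in-arc
      ; c-ii  = λ u v _ → big-M (forcingArc≤1 u v) (firstFill≤T u) λ arc≡1 →
                  let v∉C , u∈F , _ = active-arc-forces arc≡1 in firstFill-earlier v∉C u∈F
      ; c-iii = λ u v w _ uw w≢v → big-M (forcingArc≤1 u v) (firstFill≤T w) λ arc≡1 →
                  let v∉C , _ , _ , others = active-arc-forces arc≡1
                  in  firstFill-earlier v∉C (others w uw w≢v)
      ; c-iv  = firstFill≤pt
      }
      where
      firstFill≤T : ∀ v → firstFill v ≤ n ∸ 1
      firstFill≤T v = ≤-trans (firstFill≤pt v) (pt≤n∸1 pt)

  module _ {s x y z} (feasible : Feasible G s x y z) where
    open Feasible feasible

    HasEarlierForcer : Fin n → Set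
    HasEarlierForcer v =
      ∃[ u ] (adj G u v ≡ true × x u < x v × (∀ w → adj G u w ≡ true → w ≢ v → x w < x v))

    active-in-arc : ∀ {v} → s v ≡ 0 → ∃[ u ] (adj G u v ≡ true × y u v ≡ 1)
    active-in-arc {v} sv≡0 = arc (sumV≢0 λ Σ≡0 → 1+n≢0 (trans (sym Σ≡1) Σ≡0))
      where
      Σ≡1 : sumV (λ u → if adj G u v then y u v else 0) ≡ 1
      Σ≡1 = subst (λ a → a + _ ≡ 1) sv≡0 (c-i v)
      arc : ∃[ u ] (if adj G u v then y u v else 0) ≢ 0 → ∃[ u ] (adj G u v ≡ true × y u v ≡ 1)
      arc (u , arc≢0) with adj G u v in uv
      ... | true  = u , uv , ≤-antisym (y-bin u v uv) (n≢0⇒n>0 arc≢0)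
      ... | false = contradiction refl arc≢0

    earlier-forcer : ∀ {v} → s v ≡ 0 → HasEarlierForcer v
    earlier-forcer {v} sv≡0 =
      let u , uv , y≡1 = active-in-arc sv≡0
      in  u , uv , big-M-active y≡1 (c-ii u v uv) ,
          λ w uw w≢v → big-M-active y≡1 (c-iii u v w uv uw w≢v)

    filled-by-x       : ∀ t v → x v ≤ t → filledAt G (support s) t v ≡ true
    filled-via-forcer : ∀ t v → x v ≤ t → HasEarlierForcer v →
                        filledAt G (support s) t v ≡ true

    filled-by-x t v xv≤t with n≤1⇒n≡0∨n≡1 (s-bin v)
    ... | inj₁ sv≡0 = filled-via-forcer t v xv≤t (earlier-forcer sv≡0)
    ... | inj₂ sv≡1 = filledAt-mono (support s) {0} {t} z≤n v (cong (_≡ᵇ 1) sv≡1)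

    filled-via-forcer zero    v xv≤0 (_ , _ , xu<xv , _) =
      contradiction (<-≤-trans xu<xv xv≤0) λ ()
    filled-via-forcer (suc t) v xv≤t (u , uv , xu<xv , xw<xv) =
      step-forces ( filled-by-x t u (before xu<xv) , uv
                  , λ w uw w≢v → filled-by-x t w (before (xw<xv w uw w≢v)))
      where
      before : ∀ {a} → a < x v → a ≤ t
      before a<xv = s≤s⁻¹ (<-≤-trans a<xv xv≤t)

    feasible-fills : AllFilled (filledAt G (support s) z)
    feasible-fills v = filled-by-x z v (c-iv v)

optimal≤throttling : ∀ {n} {G : Graph n} {s x y z} → Optimal G s x y z →
                     ∀ {C t} → IsThC G C t → objective s z ≤ t
optimal≤throttling {G = G} {s} {z = z} (_ , optimal) {C} {t} (k , pt , |C|+k≡t) = begin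
  objective s z            ≤⟨ optimal _ _ _ _ (ForcingSolution.feasible G pt) ⟩
  sumV (indicator C) + k   ≡⟨ cong (_+ k) (sym (card≡sumV-indicator C)) ⟩
  card C + k               ≡⟨ |C|+k≡t ⟩
  t                        ∎
  where open ≤-Reasoning

corollary3p5 : ∀ {n : ℕ} (G : Graph n)
    (s : Fin n → ℕ) (x : Fin n → ℕ) (y : Fin n → Fin n → ℕ) (z : ℕ) →
    Optimal G s x y z →
    IsZeroForcingSet G (support s)
    × IsTh G (objective s z)
    × IsThC G (support s) (objective s z)
corollary3p5 G s x y z optimal@(feasible , _) =
  (z , filled) , ((support s , th-support) , λ _ _ → optimal≤throttling optimal) , th-support
  where
  filled : AllFilled (filledAt G (support s) z)
  filled = feasible-fills G feasible

  th-support : IsThC G (support s) (objective s z)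
  th-support with allFilled⇒IsPT G (support s) filled
  ... | k , pt , k≤z =
    k , pt , ≤-antisym |C|+k≤objective (optimal≤throttling optimal (k , pt , refl))
    where
    open ≤-Reasoning
    |C|+k≤objective : card (support s) + k ≤ objective s z
    |C|+k≤objective = begin
      card (support s) + k   ≡⟨ cong (_+ k) (card-support (Feasible.s-bin feasible)) ⟩
      sumV s + k             ≤⟨ +-monoʳ-≤ (sumV s) k≤z ⟩
      sumV s + z             ∎
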